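{- Let $T$ be a rotational tournament on $n>3$ vertices with symbol $S$. Then $T$ is quadrangular if and only if for every integer $m$ with $1\leq m\leq \frac{n-1}{2}$ there exist distinct two-element subsets $\{i,j\},\{k,l\}\subseteq S$ such that $i-j\equiv k-l\equiv m \pmod{n}$.
   Context: Let $n=2r+1$ and let $S$ be a set of $r$ integers in $\{1,\dots,2r\}$ such that $a+b\neq 2r+1$ for all $a,b\in S$. The rotational tournament with symbol $S$ has vertices $0,1,\dots,2r$ and an arc $a\rightarrow b$ iff $b-a \pmod{n}\in S$. $O(v)$ is the set of vertices $v$ beats and $I(v)$ the set of vertices beating $v$. A digraph is quadrangular if for all distinct $u,v$, $|O(u)\cap O(v)|\neq 1$ and $|I(u)\cap I(v)|\neq 1$. -}

module Defs where

open import Data.Nat using (ℕ; zero; suc; _+_; _*_; _∸_; _≤_; _<_)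
open import Data.Nat.DivMod using (_mod_)
open import Data.Bool using (Bool)
open import Data.Fin using (Fin; toℕ) renaming (zero to fzero)
open import Data.Fin.Subset using (Subset; _∈_; _∉_; _∩_; ∣_∣)
open import Data.Vec using (tabulate; lookup)
open import Data.Product using (_×_)
open import Relation.Binary.PropositionalEquality using (_≡_; _≢_)
open import Relation.Nullary using (¬_)

Digraph : ℕ → Set
Digraph n = Fin n → Fin n → Bool

Out : ∀ {n} → Digraph n → Fin n → Subset n
Out A u = tabulate (λ v → A u v)

In : ∀ {n} → Digraph n → Fin n → Subset n
In A v = tabulate (λ u → A u v)

Quadrangular : ∀ {n} → Digraph n → Set
Quadrangular {n} A = (u v : Fin n) → u ≢ v →
  (∣ Out A u ∩ Out A v ∣ ≢ 1) × (∣ In A u ∩ In A v ∣ ≢ 1)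

subMod : (r : ℕ) → Fin (suc (2 * r)) → Fin (suc (2 * r)) → Fin (suc (2 * r))
subMod r x y = (toℕ x + (suc (2 * r) ∸ toℕ y)) mod (suc (2 * r))

rotational : (r : ℕ) → Subset (suc (2 * r)) → Digraph (suc (2 * r))
rotational r S a b = lookup S (subMod r b a)

IsSymbol : (r : ℕ) → Subset (suc (2 * r)) → Set
IsSymbol r S =
  (fzero ∉ S) × (∣ S ∣ ≡ r) ×
  ((a b : Fin (suc (2 * r))) → a ∈ S → b ∈ S → toℕ a + toℕ b ≢ suc (2 * r))

DiffCong : (r : ℕ) → Fin (suc (2 * r)) → Fin (suc (2 * r)) → ℕ → Set
DiffCong r i j m = subMod r i j ≡ m mod (suc (2 * r))

module Submission where

-- For distinct vertices u and v, the maps w ↦ (w − u , w − v) and w ↦ (v − w , u − w) identify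
-- Out u ∩ Out v and In u ∩ In v with the pairs (i , j) ∈ S × S such that i − j ≡ v − u, and the
-- pairs for v − u and for u − v correspond by swapping.  So T is quadrangular iff no m with
-- 1 ≤ m ≤ r is a difference of two elements of S in exactly one way, and what remains is that in a
-- quadrangular T every such m is a difference at all.  Since |S| = r and S ∩ −S = ∅, counting gives
-- S ∪ −S = ℤₙ ∖ {0}.  If m is not a difference, then of x and x + m (both nonzero) exactly one lies
-- in S.  When 3m ≡ 0 this would alternate around the odd cycle 1, 1 + m, 1 + 2m (nonzero as n ∤ 3);
-- otherwise, after replacing m by −m so that m ∉ S, the vertices 0 and 3m have 2m as their only
-- common out-neighbour.

open import Defs
open import Data.Nat using (ℕ; suc; _*_; _≤_; _<_)
open import Data.Fin using (Fin)
open import Data.Fin.Subset using (Subset; _∈_)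
open import Data.Product using (_×_; ∃-syntax)
open import Data.Sum using (_⊎_)
open import Relation.Binary.PropositionalEquality using (_≡_; _≢_)
open import Relation.Nullary using (¬_)
open import Function.Bundles using (_⇔_)

open import Data.Nat as ℕ using (NonZero; _≤?_)
import Data.Nat.Properties as ℕ
open import Data.Nat.DivMod using (_mod_; m<n⇒m%n≡m)
open import Data.Nat.Divisibility using (n∣m⇒m%n≡0)
open import Data.Integer as ℤ using (ℤ; +_; 0ℤ; _+_; _-_; -_; _⊖_)
import Data.Integer.Properties as ℤ
open import Data.Integer.DivMod using (_%ℕ_; _/ℕ_; n%ℕd<d; a≡a%ℕn+[a/ℕn]*n)
open import Data.Integer.Divisibility.Signed using (_∣_; divides; ∣m∣n⇒∣m+n; ∣m⇒∣-m; ∣⇒∣ᵤ; ∣n⇒∣m*n)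
open import Data.Integer.Tactic.RingSolver using (solve-∀; solve)
open import Data.Fin as Fin using (toℕ; fromℕ<) renaming (zero to fzero)
import Data.Fin.Properties as Fin
open import Data.Fin.Subset using (_∉_; _∩_; ∣_∣; ⁅_⁆; _⊆_)
open import Data.Fin.Subset.Properties
  using (_∈?_; nonempty?; x∈p∩q⁺; x∈p∩q⁻; ∩-comm; ⊆-antisym; x∈⁅x⁆; x∈⁅y⁆⇒x≡y; x≢y⇒x∉⁅y⁆;
         ∣⁅x⁆∣≡1; p⊂q⇒∣p∣<∣q∣)
open import Data.Fin.Permutation using (permutation)
open import Data.Bool using (true; false; if_then_else_)
open import Data.Vec as Vec using (lookup; tabulate)
open import Data.Vec.Properties using (lookup⇒[]=; []=⇒lookup; lookup∘tabulate)
open import Data.Vec.Functional using (Vector; removeAt)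
open import Algebra.Properties.CommutativeMonoid.Sum ℕ.+-0-commutativeMonoid
  using (sum; sum-remove; ∑-distrib-+; sum-permute)
open import Data.List using (_∷_; [])
open import Data.Product using (_,_; proj₁; proj₂)
open import Data.Sum using (inj₁; inj₂; [_,_]′)
open import Data.Empty using (⊥; ⊥-elim)
open import Function using (_∘_; id)
open import Function.Bundles using (mk⇔)
open import Level using (0ℓ)
open import Relation.Binary using (Rel; Setoid; Decidable)
open import Relation.Binary.PropositionalEquality as ≡ using (refl; cong; cong₂; subst; subst₂)
import Relation.Binary.Reasoning.Setoid as SetoidReasoning
open import Relation.Nullary using (Dec; yes; no; ¬?; _×-dec_)
open import Relation.Nullary.Decidable using (decidable-stable; map′)

-- Counting in finite subsets

indicator : ∀ {k} → Subset k → Fin k → ℕ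
indicator p x = if lookup p x then 1 else 0

∣p∣≡sum-indicator : ∀ {k} (p : Subset k) → ∣ p ∣ ≡ sum (indicator p)
∣p∣≡sum-indicator Vec.[]            = refl
∣p∣≡sum-indicator (true  Vec.∷ p) = cong suc (∣p∣≡sum-indicator p)
∣p∣≡sum-indicator (false Vec.∷ p) = ∣p∣≡sum-indicator p

indicator≤1 : ∀ {k} (p : Subset k) x → indicator p x ≤ 1
indicator≤1 p x with lookup p x
... | true  = ℕ.≤-refl
... | false = ℕ.z≤n

indicator-∉ : ∀ {k} {p : Subset k} {x} → x ∉ p → indicator p x ≡ 0
indicator-∉ {p = p} {x} x∉p with lookup p x in eq
... | true  = ⊥-elim (x∉p (lookup⇒[]= x p eq))
... | false = refl

sum≤length : ∀ {k} (f : Vector ℕ k) → (∀ i → f i ≤ 1) → sum f ≤ k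
sum≤length {ℕ.zero} f f≤1 = ℕ.z≤n
sum≤length {suc k}  f f≤1 = ℕ.+-mono-≤ (f≤1 Fin.zero) (sum≤length (f ∘ Fin.suc) (f≤1 ∘ Fin.suc))

sum<length : ∀ {k} (f : Vector ℕ k) → (∀ i → f i ≤ 1) → ∀ i → f i ≡ 0 → sum f < k
sum<length {suc k} f f≤1 i fi≡0 = begin-strict
  sum f                        ≡⟨ sum-remove f ⟩
  f i ℕ.+ sum (removeAt f i)   ≡⟨ cong (ℕ._+ sum (removeAt f i)) fi≡0 ⟩
  sum (removeAt f i)           ≤⟨ sum≤length (removeAt f i) (f≤1 ∘ Fin.punchIn i) ⟩
  k                            <⟨ ℕ.n<1+n k ⟩
  suc k                        ∎
  where open ℕ.≤-Reasoning

sum+2≤length : ∀ {k} (f : Vector ℕ k) → (∀ i → f i ≤ 1) →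
               ∀ {i j} → i ≢ j → f i ≡ 0 → f j ≡ 0 → 2 ℕ.+ sum f ≤ k
sum+2≤length {suc k} f f≤1 {i} {j} i≢j fi≡0 fj≡0 = ℕ.s≤s (begin
  suc (sum f)                          ≡⟨ cong suc (sum-remove f) ⟩
  suc (f i ℕ.+ sum (removeAt f i))     ≡⟨ cong (λ a → suc (a ℕ.+ sum (removeAt f i))) fi≡0 ⟩
  suc (sum (removeAt f i))             ≤⟨ sum<length (removeAt f i) (f≤1 ∘ Fin.punchIn i) (Fin.punchOut i≢j)
                                             (≡.trans (cong f (Fin.punchIn-punchOut i≢j)) fj≡0) ⟩
  k                                    ∎)
  where open ℕ.≤-Reasoning

x∈p⇒⁅x⁆⊆p : ∀ {k} {p : Subset k} {x} → x ∈ p → ⁅ x ⁆ ⊆ p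
x∈p⇒⁅x⁆⊆p {p = p} {x} x∈p y∈⁅x⁆ = subst (_∈ p) (≡.sym (x∈⁅y⁆⇒x≡y x y∈⁅x⁆)) x∈p

∈-unique⇒∣p∣≡1 : ∀ {k} {p : Subset k} {x} → x ∈ p → (∀ {y} → y ∈ p → y ≡ x) → ∣ p ∣ ≡ 1
∈-unique⇒∣p∣≡1 {p = p} {x} x∈p unique = ≡.trans (cong ∣_∣ p≡⁅x⁆) (∣⁅x⁆∣≡1 x)
  where
    p≡⁅x⁆ : p ≡ ⁅ x ⁆
    p≡⁅x⁆ = ⊆-antisym (λ y∈p → subst (_∈ ⁅ x ⁆) (≡.sym (unique y∈p)) (x∈⁅x⁆ x)) (x∈p⇒⁅x⁆⊆p x∈p)

∣p∣≡1⇒∈-unique : ∀ {k} {p : Subset k} {x y} → ∣ p ∣ ≡ 1 → x ∈ p → y ∈ p → y ≡ x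
∣p∣≡1⇒∈-unique {x = x} {y} ∣p∣≡1 x∈p y∈p = decidable-stable (y Fin.≟ x) λ y≢x →
  ℕ.<-irrefl (≡.trans (∣⁅x⁆∣≡1 x) (≡.sym ∣p∣≡1))
             (p⊂q⇒∣p∣<∣q∣ (x∈p⇒⁅x⁆⊆p x∈p , y , y∈p , x≢y⇒x∉⁅y⁆ y≢x))

∣p∣≢1⇒∃≢ : ∀ {k} {p : Subset k} {x} → x ∈ p → ∣ p ∣ ≢ 1 → ∃[ y ] (y ∈ p × y ≢ x)
∣p∣≢1⇒∃≢ {p = p} {x} x∈p ∣p∣≢1 with Fin.any? (λ y → y ∈? p ×-dec ¬? (y Fin.≟ x))
... | yes ∃y = ∃y
... | no ∄y = ⊥-elim (∣p∣≢1 (∈-unique⇒∣p∣≡1 x∈p λ {y} y∈p →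
                 decidable-stable (y Fin.≟ x) (λ y≢x → ∄y (y , y∈p , y≢x))))

∈-tabulate-lookup⁺ : ∀ {k l} {p : Subset k} (g : Fin l → Fin k) {x} → g x ∈ p → x ∈ tabulate (lookup p ∘ g)
∈-tabulate-lookup⁺ {p = p} g {x} gx∈p =
  lookup⇒[]= x _ (≡.trans (lookup∘tabulate (lookup p ∘ g) x) ([]=⇒lookup gx∈p))

∈-tabulate-lookup⁻ : ∀ {k l} {p : Subset k} (g : Fin l → Fin k) {x} → x ∈ tabulate (lookup p ∘ g) → g x ∈ p
∈-tabulate-lookup⁻ {p = p} g {x} x∈t =
  lookup⇒[]= (g x) p (≡.trans (≡.sym (lookup∘tabulate (lookup p ∘ g) x)) ([]=⇒lookup x∈t))

-- Integers modulo n

module Modular (n : ℕ) .{{_ : NonZero n}} where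

  infix 4 _≈_ _≉_ _≈?_

  -- A record rather than an abbreviation of the divisibility, so that a and b can be inferred
  -- from a proof of a ≈ b; the same goes for _∈ᵣ_ below.
  record _≈_ (a b : ℤ) : Set where
    constructor n∣-
    field n∣a-b : + n ∣ a - b

  _≉_ : Rel ℤ 0ℓ
  a ≉ b = ¬ a ≈ b

  ≈-reflexive : ∀ {a b} → a ≡ b → a ≈ b
  ≈-reflexive {a} refl = n∣- (subst (+ n ∣_) (≡.sym (ℤ.+-inverseʳ a)) (divides 0ℤ refl))

  ≈-refl : ∀ {a} → a ≈ a
  ≈-refl = ≈-reflexive refl

  ≈-sym : ∀ {a b} → a ≈ b → b ≈ a
  ≈-sym {a} {b} (n∣- d) = n∣- (subst (+ n ∣_) eq (∣m⇒∣-m d))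
    where eq : - (a - b) ≡ b - a
          eq = solve (a ∷ b ∷ [])

  ≈-trans : ∀ {a b c} → a ≈ b → b ≈ c → a ≈ c
  ≈-trans {a} {b} {c} (n∣- d) (n∣- e) = n∣- (subst (+ n ∣_) eq (∣m∣n⇒∣m+n d e))
    where eq : (a - b) + (b - c) ≡ a - c
          eq = solve (a ∷ b ∷ c ∷ [])

  ≈-setoid : Setoid 0ℓ 0ℓ
  ≈-setoid = record
    { Carrier = ℤ
    ; _≈_ = _≈_
    ; isEquivalence = record { refl = ≈-refl ; sym = ≈-sym ; trans = ≈-trans }
    }

  +-cong : ∀ {a a′ b b′} → a ≈ a′ → b ≈ b′ → a + b ≈ a′ + b′
  +-cong {a} {a′} {b} {b′} (n∣- d) (n∣- e) = n∣- (subst (+ n ∣_) eq (∣m∣n⇒∣m+n d e))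
    where eq : (a - a′) + (b - b′) ≡ (a + b) - (a′ + b′)
          eq = solve (a ∷ a′ ∷ b ∷ b′ ∷ [])

  +-congˡ : ∀ a {b b′} → b ≈ b′ → a + b ≈ a + b′
  +-congˡ a = +-cong (≈-refl {a})

  +-congʳ : ∀ b {a a′} → a ≈ a′ → a + b ≈ a′ + b
  +-congʳ b a≈a′ = +-cong a≈a′ (≈-refl {b})

  -‿cong : ∀ {a b} → a ≈ b → - a ≈ - b
  -‿cong {a} {b} (n∣- d) = n∣- (subst (+ n ∣_) eq (∣m⇒∣-m d))
    where eq : - (a - b) ≡ - a - - b
          eq = solve (a ∷ b ∷ [])

  *-congˡ : ∀ k {a b} → a ≈ b → k ℤ.* a ≈ k ℤ.* b
  *-congˡ k {a} {b} (n∣- d) = n∣- (subst (+ n ∣_) eq (∣n⇒∣m*n k d))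
    where eq : k ℤ.* (a - b) ≡ k ℤ.* a - k ℤ.* b
          eq = solve (k ∷ a ∷ b ∷ [])

  n≈0 : + n ≈ 0ℤ
  n≈0 = n∣- (divides (+ 1) (≡.trans (ℤ.+-identityʳ (+ n)) (≡.sym (ℤ.*-identityˡ (+ n)))))

  ∣i∣<n∧n∣i⇒i≡0 : ∀ {i} → ℤ.∣ i ∣ < n → + n ∣ i → i ≡ 0ℤ
  ∣i∣<n∧n∣i⇒i≡0 {i} ∣i∣<n n∣i =
    ℤ.∣i∣≡0⇒i≡0 (≡.trans (≡.sym (m<n⇒m%n≡m ∣i∣<n)) (n∣m⇒m%n≡0 ℤ.∣ i ∣ n (∣⇒∣ᵤ n∣i)))

  +-≈-injective : ∀ {a b} → a < n → b < n → + a ≈ + b → a ≡ b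
  +-≈-injective {a} {b} a<n b<n (n∣- n∣a-b) =
    ℤ.+-injective (ℤ.i-j≡0⇒i≡j (+ a) (+ b) (∣i∣<n∧n∣i⇒i≡0 ∣a-b∣<n n∣a-b))
    where
      ∣a-b∣<n : ℤ.∣ + a - + b ∣ < n
      ∣a-b∣<n = subst (_< n) (cong ℤ.∣_∣ (≡.sym (ℤ.m-n≡m⊖n a b)))
                  (ℕ.≤-<-trans (ℤ.∣m⊝n∣≤m⊔n a b) (ℕ.⊔-pres-<m a<n b<n))

  +≉0 : ∀ {a} → 0 < a → a < n → + a ≉ 0ℤ
  +≉0 0<a a<n a≈0 = ℕ.<⇒≢ 0<a (≡.sym (+-≈-injective a<n (ℕ.<-trans 0<a a<n) a≈0))

  +[n∸a]≈-a : ∀ {a} → a ≤ n → + (n ℕ.∸ a) ≈ - + a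
  +[n∸a]≈-a {a} a≤n = begin
    + (n ℕ.∸ a)  ≡⟨ ℤ.⊖-≥ a≤n ⟨
    n ⊖ a        ≡⟨ ℤ.m-n≡m⊖n n a ⟨
    + n - + a    ≈⟨ +-congʳ (- + a) n≈0 ⟩
    0ℤ - + a     ≡⟨ ℤ.+-identityˡ (- + a) ⟩
    - + a        ∎
    where open SetoidReasoning ≈-setoid

  x+y≈0⇒x≈-y : ∀ {x y} → x + y ≈ 0ℤ → x ≈ - y
  x+y≈0⇒x≈-y {x} {y} x+y≈0 = begin
    x           ≡⟨ solve (x ∷ y ∷ []) ⟩
    x + y - y   ≈⟨ +-congʳ (- y) x+y≈0 ⟩
    0ℤ - y      ≡⟨ ℤ.+-identityˡ (- y) ⟩
    - y         ∎
    where open SetoidReasoning ≈-setoid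

  -‿≉0 : ∀ {z} → z ≉ 0ℤ → - z ≉ 0ℤ
  -‿≉0 {z} z≉0 -z≈0 = z≉0 (≈-trans (≈-reflexive (≡.sym (ℤ.neg-involutive z))) (-‿cong -z≈0))

  x-y≈0⇒x≈y : ∀ {x y} → x - y ≈ 0ℤ → x ≈ y
  x-y≈0⇒x≈y {x} {y} x-y≈0 = ≈-trans (x+y≈0⇒x≈-y x-y≈0) (≈-reflexive (ℤ.neg-involutive y))

  +-cancelʳ-≈ : ∀ c {a b} → a + c ≈ b + c → a ≈ b
  +-cancelʳ-≈ c {a} {b} a+c≈b+c = begin
    a           ≡⟨ solve (a ∷ c ∷ []) ⟩
    a + c - c   ≈⟨ +-congʳ (- c) a+c≈b+c ⟩
    b + c - c   ≡⟨ solve (b ∷ c ∷ []) ⟩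
    b           ∎
    where open SetoidReasoning ≈-setoid

  difference-cancelˡ : ∀ {a b c d} → a - b ≈ c - d → a ≈ c → b ≈ d
  difference-cancelˡ {a} {b} {c} {d} a-b≈c-d a≈c = begin
    b              ≡⟨ solve (a ∷ b ∷ []) ⟩
    a - (a - b)    ≈⟨ +-cong a≈c (-‿cong a-b≈c-d) ⟩
    c - (c - d)    ≡⟨ solve (c ∷ d ∷ []) ⟩
    d              ∎
    where open SetoidReasoning ≈-setoid

  difference-cancelʳ : ∀ {a b c d} → a - b ≈ c - d → b ≈ d → a ≈ c
  difference-cancelʳ {a} {b} {c} {d} a-b≈c-d b≈d = begin
    a              ≡⟨ solve (a ∷ b ∷ []) ⟩
    a - b + b      ≈⟨ +-cong a-b≈c-d b≈d ⟩
    c - d + d      ≡⟨ solve (c ∷ d ∷ []) ⟩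
    c              ∎
    where open SetoidReasoning ≈-setoid

  opposite-differences : ∀ a b {d} → a - b ≈ d → b - a ≈ d → d + d ≈ 0ℤ
  opposite-differences a b {d} a-b≈d b-a≈d = begin
    d + d                ≈⟨ +-cong a-b≈d b-a≈d ⟨
    (a - b) + (b - a)    ≡⟨ solve (a ∷ b ∷ []) ⟩
    0ℤ                   ∎
    where open SetoidReasoning ≈-setoid

  toℤ : Fin n → ℤ
  toℤ x = + toℕ x

  -- Opaque, so that unification treats residue as rigid instead of unfolding it into _%ℕ_.
  opaque
    residue : ℤ → Fin n
    residue z = fromℕ< (n%ℕd<d z n)

    toℤ-residue : ∀ z → toℤ (residue z) ≈ z
    toℤ-residue z = ≈-sym (n∣- (divides (z /ℕ n) (begin
      z - toℤ (residue z)                            ≡⟨ cong (λ k → z - + k) (Fin.toℕ-fromℕ< _) ⟩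
      z - + (z %ℕ n)                                 ≡⟨ cong (_- + (z %ℕ n)) (a≡a%ℕn+[a/ℕn]*n z n) ⟩
      + (z %ℕ n) + (z /ℕ n) ℤ.* + n - + (z %ℕ n)     ≡⟨ a+b-a≡b (+ (z %ℕ n)) ((z /ℕ n) ℤ.* + n) ⟩
      (z /ℕ n) ℤ.* + n                               ∎)))
      where
        open ≡.≡-Reasoning
        a+b-a≡b : ∀ a b → a + b - a ≡ b
        a+b-a≡b = solve-∀

    mod≡residue : ∀ m → m mod n ≡ residue (+ m)
    mod≡residue m = refl

  toℤ-≈-injective : ∀ {x y} → toℤ x ≈ toℤ y → x ≡ y
  toℤ-≈-injective {x} {y} x≈y = Fin.toℕ-injective (+-≈-injective (Fin.toℕ<n x) (Fin.toℕ<n y) x≈y)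

  residue-cong : ∀ {a b} → a ≈ b → residue a ≡ residue b
  residue-cong {a} {b} a≈b = toℤ-≈-injective (≈-trans (toℤ-residue a) (≈-trans a≈b (≈-sym (toℤ-residue b))))

  residue-injective : ∀ {a b} → residue a ≡ residue b → a ≈ b
  residue-injective {a} {b} eq =
    ≈-trans (≈-sym (toℤ-residue a)) (subst (λ x → toℤ x ≈ b) (≡.sym eq) (toℤ-residue b))

  residue-toℤ : ∀ x → residue (toℤ x) ≡ x
  residue-toℤ x = toℤ-≈-injective (toℤ-residue (toℤ x))

  _≈?_ : Decidable _≈_
  a ≈? b with residue a Fin.≟ residue b
  ... | yes eq = yes (residue-injective eq)
  ... | no neq = no (neq ∘ residue-cong)

  residue-difference : ∀ a b → toℤ (residue a) - toℤ (residue b) ≈ a - b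
  residue-difference a b = +-cong (toℤ-residue a) (-‿cong (toℤ-residue b))

  infix 4 _∈ᵣ_ _∉ᵣ_ _∈ᵣ?_

  record _∈ᵣ_ (z : ℤ) (S : Subset n) : Set where
    constructor residue∈
    field ∈ᵣ⇒residue∈ : residue z ∈ S
  open _∈ᵣ_ public

  _∉ᵣ_ : ℤ → Subset n → Set
  z ∉ᵣ S = ¬ z ∈ᵣ S

  _∈ᵣ?_ : ∀ z S → Dec (z ∈ᵣ S)
  z ∈ᵣ? S = map′ residue∈ ∈ᵣ⇒residue∈ (residue z ∈? S)

  ∈ᵣ-resp-≈ : ∀ {S a b} → a ≈ b → a ∈ᵣ S → b ∈ᵣ S
  ∈ᵣ-resp-≈ {S} a≈b (residue∈ a∈S) = residue∈ (subst (_∈ S) (residue-cong a≈b) a∈S)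

  ∈⇒toℤ-∈ᵣ : ∀ {S x} → x ∈ S → toℤ x ∈ᵣ S
  ∈⇒toℤ-∈ᵣ {S} {x} x∈S = residue∈ (subst (_∈ S) (≡.sym (residue-toℤ x)) x∈S)

  neg : Fin n → Fin n
  neg x = residue (- toℤ x)

  neg-involutive : ∀ x → neg (neg x) ≡ x
  neg-involutive x = toℤ-≈-injective (begin
    toℤ (neg (neg x))  ≈⟨ toℤ-residue _ ⟩
    - toℤ (neg x)      ≈⟨ -‿cong (toℤ-residue _) ⟩
    - - toℤ x          ≡⟨ ℤ.neg-involutive (toℤ x) ⟩
    toℤ x              ∎)
    where open SetoidReasoning ≈-setoid

  neg-residue : ∀ z → neg (residue z) ≡ residue (- z)
  neg-residue z = residue-cong (-‿cong (toℤ-residue z))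

  sum-indicator±≡2∣p∣ : ∀ p → sum (λ x → indicator p x ℕ.+ indicator p (neg x)) ≡ 2 * ∣ p ∣
  sum-indicator±≡2∣p∣ p = begin-equality
    sum (λ x → indicator p x ℕ.+ indicator p (neg x))   ≡⟨ ∑-distrib-+ (indicator p) (indicator p ∘ neg) ⟩
    sum (indicator p) ℕ.+ sum (indicator p ∘ neg)       ≡⟨ cong (sum (indicator p) ℕ.+_)
                                                             (sum-permute (indicator p) neg-permutation) ⟨
    sum (indicator p) ℕ.+ sum (indicator p)             ≡⟨ cong (λ k → k ℕ.+ k) (∣p∣≡sum-indicator p) ⟨
    ∣ p ∣ ℕ.+ ∣ p ∣                                     ≡⟨ cong (∣ p ∣ ℕ.+_) (ℕ.+-identityʳ ∣ p ∣) ⟨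
    2 * ∣ p ∣                                           ∎
    where
      open ℕ.≤-Reasoning
      neg-permutation = permutation neg neg neg-involutive neg-involutive

  -- T x = [x ∈ S] + [−x ∈ S] is at most 1 and sums to 2 ∣ S ∣ = n − 1, so it vanishes at most
  -- once; but a nonzero z with z, −z ∉ S makes it vanish at both 0 and z.
  asym∧card⇒total : ∀ {S} → (∀ {z} → z ∈ᵣ S → - z ∉ᵣ S) → suc (2 * ∣ S ∣) ≡ n →
                    ∀ {z} → z ≉ 0ℤ → z ∈ᵣ S ⊎ - z ∈ᵣ S
  asym∧card⇒total {S} asym card {z} z≉0 with z ∈ᵣ? S | - z ∈ᵣ? S
  ... | yes z∈S | _          = inj₁ z∈S
  ... | no _    | yes -z∈S   = inj₂ -z∈S
  ... | no z∉S  | no -z∉S    = ⊥-elim (ℕ.<-irrefl refl (begin-strict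
    suc (2 * ∣ S ∣)          <⟨ ℕ.n<1+n _ ⟩
    2 ℕ.+ 2 * ∣ S ∣          ≡⟨ cong (2 ℕ.+_) (sum-indicator±≡2∣p∣ S) ⟨
    2 ℕ.+ sum T              ≤⟨ sum+2≤length T T≤1 0≢z (T≡0 0∉S 0∉S) (T≡0 z∉S -z∉S) ⟩
    n                        ≡⟨ card ⟨
    suc (2 * ∣ S ∣)          ∎))
    where
      open ℕ.≤-Reasoning
      T : Fin n → ℕ
      T x = indicator S x ℕ.+ indicator S (neg x)

      T≤1 : ∀ x → T x ≤ 1
      T≤1 x with x ∈? S
      ... | yes x∈S = subst (_≤ 1) (≡.sym Tx≡) (indicator≤1 S x)
        where
          Tx≡ : T x ≡ indicator S x
          Tx≡ = ≡.trans (cong (indicator S x ℕ.+_) (indicator-∉ (asym (∈⇒toℤ-∈ᵣ x∈S) ∘ residue∈)))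
                        (ℕ.+-identityʳ (indicator S x))
      ... | no x∉S = subst (_≤ 1) (cong (ℕ._+ indicator S (neg x)) (≡.sym (indicator-∉ x∉S)))
                       (indicator≤1 S (neg x))

      T≡0 : ∀ {y} → y ∉ᵣ S → - y ∉ᵣ S → T (residue y) ≡ 0
      T≡0 {y} y∉S -y∉S = cong₂ ℕ._+_ (indicator-∉ (y∉S ∘ residue∈))
        (≡.trans (cong (indicator S) (neg-residue y)) (indicator-∉ (-y∉S ∘ residue∈)))

      0∉S : 0ℤ ∉ᵣ S
      0∉S 0∈S = asym 0∈S 0∈S

      0≢z : residue 0ℤ ≢ residue z
      0≢z 0≡z = z≉0 (≈-sym (residue-injective 0≡z))

  -- Tournament symbols

  record IsTournamentSymbol (S : Subset n) : Set where
    field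
      asym  : ∀ {z} → z ∈ᵣ S → - z ∉ᵣ S
      total : ∀ {z} → z ≉ 0ℤ → z ∈ᵣ S ⊎ - z ∈ᵣ S

  NonDifference : Subset n → ℤ → Set
  NonDifference S m = ∀ {x} → x ∈ᵣ S → x + m ∉ᵣ S

  nonDifference-resp-≈ : ∀ {S m m′} → m ≈ m′ → NonDifference S m → NonDifference S m′
  nonDifference-resp-≈ m≈m′ nd {x} x∈S x+m′∈S = nd x∈S (∈ᵣ-resp-≈ (+-congˡ x (≈-sym m≈m′)) x+m′∈S)

  module TournamentSymbol {S : Subset n} (S-tournament : IsTournamentSymbol S) where
    open IsTournamentSymbol S-tournament using (total)

    ∉ᵣ⇒-∈ᵣ : ∀ {z} → z ≉ 0ℤ → z ∉ᵣ S → - z ∈ᵣ S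
    ∉ᵣ⇒-∈ᵣ z≉0 z∉S = [ (λ z∈S → ⊥-elim (z∉S z∈S)) , id ]′ (total z≉0)

    nonDifference-neg : ∀ {m} → NonDifference S m → NonDifference S (- m)
    nonDifference-neg {m} nd {x} x∈S x-m∈S = nd x-m∈S (subst (_∈ᵣ S) x≡x-m+m x∈S)
      where
        x≡x-m+m : x ≡ x - m + m
        x≡x-m+m = solve (x ∷ m ∷ [])

    nonDifference-covers : ∀ {m x} → NonDifference S m → x ≉ 0ℤ → x + m ≉ 0ℤ → x ∈ᵣ S ⊎ x + m ∈ᵣ S
    nonDifference-covers {m} {x} nd x≉0 x+m≉0 with x ∈ᵣ? S | x + m ∈ᵣ? S
    ... | yes x∈S | _         = inj₁ x∈S
    ... | no _    | yes x+m∈S = inj₂ x+m∈S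
    ... | no x∉S  | no x+m∉S  =
      ⊥-elim (nd (∉ᵣ⇒-∈ᵣ x+m≉0 x+m∉S) (subst (_∈ᵣ S) -x≡-[x+m]+m (∉ᵣ⇒-∈ᵣ x≉0 x∉S)))
      where
        -x≡-[x+m]+m : - x ≡ - (x + m) + m
        -x≡-[x+m]+m = solve (x ∷ m ∷ [])

    -- Membership in S would have to alternate around the 3-cycle a, b, c (as c + m ≈ a).
    nonDifference-of-order-3 : ∀ {m} → + 3 ≉ 0ℤ → m + m + m ≈ 0ℤ → ¬ NonDifference S m
    nonDifference-of-order-3 {m} 3≉0 3m≈0 nd = around-the-cycle (a ∈ᵣ? S)
      where
        open SetoidReasoning ≈-setoid
        a b c : ℤ
        a = + 1
        b = a + m
        c = b + m

        ≉0-since-3≉0 : ∀ x k → + 3 ≡ + 3 ℤ.* x + k ℤ.* (m + m + m) → x ≉ 0ℤ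
        ≉0-since-3≉0 x k 3≡3x+k[3m] x≈0 = 3≉0 (begin
          + 3                              ≡⟨ 3≡3x+k[3m] ⟩
          + 3 ℤ.* x + k ℤ.* (m + m + m)    ≈⟨ +-cong (*-congˡ (+ 3) x≈0) (*-congˡ k 3m≈0) ⟩
          + 3 ℤ.* 0ℤ + k ℤ.* 0ℤ            ≡⟨ ≡.trans (ℤ.+-identityˡ (k ℤ.* 0ℤ)) (ℤ.*-zeroʳ k) ⟩
          0ℤ                               ∎)

        c+m≈a : c + m ≈ a
        c+m≈a = begin
          + 1 + m + m + m    ≡⟨ solve (m ∷ []) ⟩
          a + (m + m + m)    ≈⟨ +-congˡ a 3m≈0 ⟩
          a + 0ℤ             ≡⟨⟩
          a                  ∎

        a≉0 : a ≉ 0ℤ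
        a≉0 = ≉0-since-3≉0 a 0ℤ refl
        b≉0 : b ≉ 0ℤ
        b≉0 = ≉0-since-3≉0 (+ 1 + m) (- + 1) (solve (m ∷ []))
        c≉0 : c ≉ 0ℤ
        c≉0 = ≉0-since-3≉0 (+ 1 + m + m) (- + 2) (solve (m ∷ []))

        around-the-cycle : Dec (a ∈ᵣ S) → ⊥
        around-the-cycle (yes a∈S) =
          [ nd a∈S , (λ c∈S → nd c∈S (∈ᵣ-resp-≈ (≈-sym c+m≈a) a∈S)) ]′ (nonDifference-covers nd b≉0 c≉0)
        around-the-cycle (no a∉S) =
          [ a∉S , (λ b∈S → [ nd b∈S , a∉S ∘ ∈ᵣ-resp-≈ c+m≈a ]′
                              (nonDifference-covers nd c≉0 (a≉0 ∘ ≈-trans (≈-sym c+m≈a)))) ]′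
            (nonDifference-covers nd a≉0 b≉0)

    nonDifference-unique : ∀ {m t} → NonDifference S m → m ∉ᵣ S → m ≉ 0ℤ →
                           t ∈ᵣ S → t + (m + m + m) ∈ᵣ S → t ≈ - m
    nonDifference-unique {m} {t} nd m∉S m≉0 t∈S t+3m∈S = by-cases (t + m ≈? 0ℤ) (t + m + m ≈? 0ℤ)
      where
        by-cases : Dec (t + m ≈ 0ℤ) → Dec (t + m + m ≈ 0ℤ) → t ≈ - m
        by-cases (yes t+m≈0) _ = x+y≈0⇒x≈-y t+m≈0
        by-cases (no _) (yes t+2m≈0) =
          ⊥-elim (nd t∈S (∈ᵣ-resp-≈ (≈-sym (x+y≈0⇒x≈-y t+2m≈0)) (∉ᵣ⇒-∈ᵣ m≉0 m∉S)))
        by-cases (no t+m≉0) (no t+2m≉0) =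
          ⊥-elim ([ nd t∈S , (λ t+2m∈S → nd t+2m∈S (subst (_∈ᵣ S) t+3m≡t+m+m+m t+3m∈S)) ]′
                    (nonDifference-covers nd t+m≉0 t+2m≉0))
          where
            t+3m≡t+m+m+m : t + (m + m + m) ≡ t + m + m + m
            t+3m≡t+m+m+m = solve (t ∷ m ∷ [])
-- The rotational tournament

module RotationalTournament (r : ℕ) (S : Subset (suc (2 * r))) (isSymbol : IsSymbol r S) where

  n : ℕ
  n = suc (2 * r)

  open Modular n

  A : Digraph n
  A = rotational r S

  subMod≡residue : ∀ x y → subMod r x y ≡ residue (toℤ x - toℤ y)
  subMod≡residue x y = ≡.trans (mod≡residue _) (residue-cong (begin
    + (toℕ x ℕ.+ (n ℕ.∸ toℕ y))   ≡⟨ ℤ.pos-+ (toℕ x) _ ⟩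
    toℤ x + + (n ℕ.∸ toℕ y)       ≈⟨ +-congˡ (toℤ x) (+[n∸a]≈-a (ℕ.<⇒≤ (Fin.toℕ<n y))) ⟩
    toℤ x - toℤ y                 ∎))
    where open SetoidReasoning ≈-setoid

  DiffCong⁺ : ∀ i j {m} → toℤ i - toℤ j ≈ + m → DiffCong r i j m
  DiffCong⁺ i j {m} i-j≈m =
    ≡.trans (subMod≡residue i j) (≡.trans (residue-cong i-j≈m) (≡.sym (mod≡residue m)))

  DiffCong⁻ : ∀ i j {m} → DiffCong r i j m → toℤ i - toℤ j ≈ + m
  DiffCong⁻ i j {m} i-j≡m =
    residue-injective (≡.trans (≡.sym (subMod≡residue i j)) (≡.trans i-j≡m (mod≡residue m)))

  ∈Out⁺ : ∀ u w → toℤ w - toℤ u ∈ᵣ S → w ∈ Out A u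
  ∈Out⁺ u w (residue∈ w-u∈S) =
    ∈-tabulate-lookup⁺ (λ v → subMod r v u) (subst (_∈ S) (≡.sym (subMod≡residue w u)) w-u∈S)

  ∈Out⁻ : ∀ u w → w ∈ Out A u → toℤ w - toℤ u ∈ᵣ S
  ∈Out⁻ u w w∈Out =
    residue∈ (subst (_∈ S) (subMod≡residue w u) (∈-tabulate-lookup⁻ (λ v → subMod r v u) w∈Out))

  ∈In⁺ : ∀ v w → toℤ v - toℤ w ∈ᵣ S → w ∈ In A v
  ∈In⁺ v w (residue∈ v-w∈S) =
    ∈-tabulate-lookup⁺ (subMod r v) (subst (_∈ S) (≡.sym (subMod≡residue v w)) v-w∈S)

  ∈Out∩⁺ : ∀ u v w → toℤ w - toℤ u ∈ᵣ S → toℤ w - toℤ v ∈ᵣ S → w ∈ Out A u ∩ Out A v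
  ∈Out∩⁺ u v w w-u∈S w-v∈S = x∈p∩q⁺ (∈Out⁺ u w w-u∈S , ∈Out⁺ v w w-v∈S)

  ∈Out∩⁻ : ∀ u v w → w ∈ Out A u ∩ Out A v → toℤ w - toℤ u ∈ᵣ S × toℤ w - toℤ v ∈ᵣ S
  ∈Out∩⁻ u v w w∈ = let w∈Out-u , w∈Out-v = x∈p∩q⁻ (Out A u) (Out A v) w∈ in
    ∈Out⁻ u w w∈Out-u , ∈Out⁻ v w w∈Out-v

  S-asym : ∀ {z} → z ∈ᵣ S → - z ∉ᵣ S
  S-asym {z} (residue∈ x∈S) (residue∈ y∈S) = proj₂ (proj₂ isSymbol) x y x∈S y∈S a+toℕy≡n
    where
      x = residue z
      y = residue (- z)
      a = toℕ x
      0<a : 0 < a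
      0<a = ℕ.n≢0⇒n>0 λ a≡0 → proj₁ isSymbol (subst (_∈ S) (Fin.toℕ-injective {j = fzero} a≡0) x∈S)
      a≤n : a ≤ n
      a≤n = ℕ.<⇒≤ (Fin.toℕ<n x)
      toℕy≡n∸a : toℕ y ≡ n ℕ.∸ a
      toℕy≡n∸a = +-≈-injective (Fin.toℕ<n y) (ℕ.∸-monoʳ-< 0<a a≤n) (begin
        toℤ y          ≈⟨ toℤ-residue (- z) ⟩
        - z            ≈⟨ -‿cong (toℤ-residue z) ⟨
        - toℤ x        ≈⟨ +[n∸a]≈-a a≤n ⟨
        + (n ℕ.∸ a)    ∎)
        where open SetoidReasoning ≈-setoid
      a+toℕy≡n : a ℕ.+ toℕ y ≡ n
      a+toℕy≡n = ≡.trans (cong (a ℕ.+_) toℕy≡n∸a) (ℕ.m+[n∸m]≡n a≤n)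

  S-tournament : IsTournamentSymbol S
  S-tournament = record
    { asym  = S-asym
    ; total = asym∧card⇒total S-asym (cong (λ k → suc (2 * k)) (proj₁ (proj₂ isSymbol)))
    }

  open TournamentSymbol S-tournament

  ≉0⇒±representative : ∀ {z} → z ≉ 0ℤ → ∃[ m ] (1 ≤ m × m ≤ r × (+ m ≈ z ⊎ + m ≈ - z))
  ≉0⇒±representative {z} z≉0 = choose (a ≤? r)
    where
      a = toℕ (residue z)
      0<a : 0 < a
      0<a = ℕ.n≢0⇒n>0 λ a≡0 → z≉0 (≈-trans (≈-sym (toℤ-residue z)) (≈-reflexive (cong +_ a≡0)))
      a≤n : a ≤ n
      a≤n = ℕ.<⇒≤ (Fin.toℕ<n (residue z))
      choose : Dec (a ≤ r) → ∃[ m ] (1 ≤ m × m ≤ r × (+ m ≈ z ⊎ + m ≈ - z))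
      choose (yes a≤r) = a , 0<a , a≤r , inj₁ (toℤ-residue z)
      choose (no a≰r) = n ℕ.∸ a , ℕ.m<n⇒0<n∸m (Fin.toℕ<n (residue z)) , ℕ.m≤n+o⇒m∸n≤o n a n≤a+r ,
                        inj₂ (≈-trans (+[n∸a]≈-a a≤n) (-‿cong (toℤ-residue z)))
        where
          n≤a+r : n ≤ a ℕ.+ r
          n≤a+r = ℕ.≤-trans (ℕ.≤-reflexive (cong (suc ∘ (r ℕ.+_)) (ℕ.+-identityʳ r)))
                            (ℕ.+-monoˡ-≤ r (ℕ.≰⇒> a≰r))

  m≤r⇒m+m<n : ∀ {m} → m ≤ r → m ℕ.+ m < n
  m≤r⇒m+m<n m≤r = ℕ.s≤s (ℕ.+-mono-≤ m≤r (ℕ.≤-trans m≤r (ℕ.≤-reflexive (≡.sym (ℕ.+-identityʳ _)))))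

  TwoRepresentations : ℕ → Set
  TwoRepresentations m =
    ∃[ i ] ∃[ j ] ∃[ k ] ∃[ l ]
      (i ∈ S × j ∈ S × k ∈ S × l ∈ S × i ≢ j × k ≢ l ×
       ¬ ((i ≡ k × j ≡ l) ⊎ (i ≡ l × j ≡ k)) ×
       DiffCong r i j m × DiffCong r k l m)

  common-successor : ∀ u v {i j} → i ∈ S → j ∈ S → toℤ i - toℤ j ≈ toℤ v - toℤ u →
                     residue (toℤ i + toℤ u) ∈ Out A u ∩ Out A v
  common-successor u v {i} {j} i∈S j∈S i-j≈v-u =
    ∈Out∩⁺ u v w (∈ᵣ-resp-≈ (≈-sym w-u≈i) (∈⇒toℤ-∈ᵣ i∈S)) (∈ᵣ-resp-≈ (≈-sym w-v≈j) (∈⇒toℤ-∈ᵣ j∈S))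
    where
      open SetoidReasoning ≈-setoid
      a+b-b≡a : ∀ a b → a + b - b ≡ a
      a+b-b≡a = solve-∀
      a+b-c≡a-[c-b] : ∀ a b c → a + b - c ≡ a - (c - b)
      a+b-c≡a-[c-b] = solve-∀
      a-[a-b]≡b : ∀ a b → a - (a - b) ≡ b
      a-[a-b]≡b = solve-∀
      w = residue (toℤ i + toℤ u)
      w-u≈i : toℤ w - toℤ u ≈ toℤ i
      w-u≈i = begin
        toℤ w - toℤ u                  ≈⟨ +-congʳ (- toℤ u) (toℤ-residue (toℤ i + toℤ u)) ⟩
        toℤ i + toℤ u - toℤ u          ≡⟨ a+b-b≡a (toℤ i) (toℤ u) ⟩
        toℤ i                          ∎
      w-v≈j : toℤ w - toℤ v ≈ toℤ j
      w-v≈j = begin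
        toℤ w - toℤ v                  ≈⟨ +-congʳ (- toℤ v) (toℤ-residue (toℤ i + toℤ u)) ⟩
        toℤ i + toℤ u - toℤ v          ≡⟨ a+b-c≡a-[c-b] (toℤ i) (toℤ u) (toℤ v) ⟩
        toℤ i - (toℤ v - toℤ u)        ≈⟨ +-congˡ (toℤ i) (-‿cong i-j≈v-u) ⟨
        toℤ i - (toℤ i - toℤ j)        ≡⟨ a-[a-b]≡b (toℤ i) (toℤ j) ⟩
        toℤ j                          ∎

  common-predecessor : ∀ u v {i j} → i ∈ S → j ∈ S → toℤ i - toℤ j ≈ toℤ v - toℤ u →
                       residue (toℤ u - toℤ j) ∈ In A u ∩ In A v
  common-predecessor u v {i} {j} i∈S j∈S i-j≈v-u =
    x∈p∩q⁺ ( ∈In⁺ u w (∈ᵣ-resp-≈ (≈-sym u-w≈j) (∈⇒toℤ-∈ᵣ j∈S))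
           , ∈In⁺ v w (∈ᵣ-resp-≈ (≈-sym v-w≈i) (∈⇒toℤ-∈ᵣ i∈S)) )
    where
      open SetoidReasoning ≈-setoid
      a-[a-b]≡b : ∀ a b → a - (a - b) ≡ b
      a-[a-b]≡b = solve-∀
      a-[b-c]≡[a-b]+c : ∀ a b c → a - (b - c) ≡ (a - b) + c
      a-[b-c]≡[a-b]+c = solve-∀
      a-b+b≡a : ∀ a b → a - b + b ≡ a
      a-b+b≡a = solve-∀
      w = residue (toℤ u - toℤ j)
      u-w≈j : toℤ u - toℤ w ≈ toℤ j
      u-w≈j = begin
        toℤ u - toℤ w                  ≈⟨ +-congˡ (toℤ u) (-‿cong (toℤ-residue (toℤ u - toℤ j))) ⟩
        toℤ u - (toℤ u - toℤ j)        ≡⟨ a-[a-b]≡b (toℤ u) (toℤ j) ⟩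
        toℤ j                          ∎
      v-w≈i : toℤ v - toℤ w ≈ toℤ i
      v-w≈i = begin
        toℤ v - toℤ w                  ≈⟨ +-congˡ (toℤ v) (-‿cong (toℤ-residue (toℤ u - toℤ j))) ⟩
        toℤ v - (toℤ u - toℤ j)        ≡⟨ a-[b-c]≡[a-b]+c (toℤ v) (toℤ u) (toℤ j) ⟩
        (toℤ v - toℤ u) + toℤ j        ≈⟨ +-congʳ (toℤ j) i-j≈v-u ⟨
        (toℤ i - toℤ j) + toℤ j        ≡⟨ a-b+b≡a (toℤ i) (toℤ j) ⟩
        toℤ i                          ∎

  twoRepresentations⇒∣∩∣≢1 : ∀ {m} u v → + m ≈ toℤ v - toℤ u → TwoRepresentations m →
                             ∣ Out A u ∩ Out A v ∣ ≢ 1 × ∣ In A u ∩ In A v ∣ ≢ 1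
  twoRepresentations⇒∣∩∣≢1 u v m≈v-u
    (i , j , k , l , i∈S , j∈S , k∈S , l∈S , _ , _ , distinct , i-j≡m , k-l≡m) =
    (λ ∣∩∣≡1 → distinct (inj₁ (same-successor (∣p∣≡1⇒∈-unique ∣∩∣≡1
                 (common-successor u v i∈S j∈S i-j≈v-u) (common-successor u v k∈S l∈S k-l≈v-u))))) ,
    (λ ∣∩∣≡1 → distinct (inj₁ (same-predecessor (∣p∣≡1⇒∈-unique ∣∩∣≡1
                 (common-predecessor u v i∈S j∈S i-j≈v-u) (common-predecessor u v k∈S l∈S k-l≈v-u)))))
    where
      i-j≈v-u : toℤ i - toℤ j ≈ toℤ v - toℤ u
      i-j≈v-u = ≈-trans (DiffCong⁻ i j i-j≡m) m≈v-u
      k-l≈v-u : toℤ k - toℤ l ≈ toℤ v - toℤ u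
      k-l≈v-u = ≈-trans (DiffCong⁻ k l k-l≡m) m≈v-u
      i-j≈k-l : toℤ i - toℤ j ≈ toℤ k - toℤ l
      i-j≈k-l = ≈-trans i-j≈v-u (≈-sym k-l≈v-u)
      same-successor : residue (toℤ k + toℤ u) ≡ residue (toℤ i + toℤ u) → i ≡ k × j ≡ l
      same-successor eq = i≡k , toℤ-≈-injective (difference-cancelˡ i-j≈k-l (≈-reflexive (cong toℤ i≡k)))
        where
          i≡k : i ≡ k
          i≡k = toℤ-≈-injective (+-cancelʳ-≈ (toℤ u) (residue-injective (≡.sym eq)))
      same-predecessor : residue (toℤ u - toℤ l) ≡ residue (toℤ u - toℤ j) → i ≡ k × j ≡ l
      same-predecessor eq = toℤ-≈-injective (difference-cancelʳ i-j≈k-l (≈-reflexive (cong toℤ j≡l))) , j≡l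
        where
          j≡l : j ≡ l
          j≡l = toℤ-≈-injective (difference-cancelˡ (residue-injective (≡.sym eq)) (≈-refl {toℤ u}))

  twoRepresentations⇒quadrangular : (∀ m → 1 ≤ m → m ≤ r → TwoRepresentations m) → Quadrangular A
  twoRepresentations⇒quadrangular reps u v u≢v = by-representative (≉0⇒±representative v-u≉0)
    where
      v-u≉0 : toℤ v - toℤ u ≉ 0ℤ
      v-u≉0 = u≢v ∘ ≡.sym ∘ toℤ-≈-injective ∘ x-y≈0⇒x≈y
      by-representative : ∃[ m ] (1 ≤ m × m ≤ r × (+ m ≈ toℤ v - toℤ u ⊎ + m ≈ - (toℤ v - toℤ u))) →
                          ∣ Out A u ∩ Out A v ∣ ≢ 1 × ∣ In A u ∩ In A v ∣ ≢ 1
      by-representative (m , 1≤m , m≤r , inj₁ m≈v-u) = twoRepresentations⇒∣∩∣≢1 u v m≈v-u (reps m 1≤m m≤r)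
      by-representative (m , 1≤m , m≤r , inj₂ m≈-[v-u]) =
        subst (λ p → ∣ p ∣ ≢ 1) (∩-comm (Out A v) (Out A u)) (proj₁ swapped) ,
        subst (λ p → ∣ p ∣ ≢ 1) (∩-comm (In A v) (In A u)) (proj₂ swapped)
        where
          -[a-b]≡b-a : ∀ a b → - (a - b) ≡ b - a
          -[a-b]≡b-a = solve-∀
          swapped : ∣ Out A v ∩ Out A u ∣ ≢ 1 × ∣ In A v ∩ In A u ∣ ≢ 1
          swapped = twoRepresentations⇒∣∩∣≢1 v u (≈-trans m≈-[v-u] (≈-reflexive (-[a-b]≡b-a (toℤ v) (toℤ u))))
                      (reps m 1≤m m≤r)

  noCommonSuccessor⇒nonDifference : ∀ u v → ¬ (∃[ w ] (w ∈ Out A u ∩ Out A v)) →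
                                    NonDifference S (toℤ v - toℤ u)
  noCommonSuccessor⇒nonDifference u v ∄w {x} x∈S x+v-u∈S =
    ∄w (w , ∈Out∩⁺ u v w (∈ᵣ-resp-≈ (≈-sym w-u≈) x+v-u∈S) (∈ᵣ-resp-≈ (≈-sym w-v≈x) x∈S))
    where
      open SetoidReasoning ≈-setoid
      a+b-c≡a+[b-c] : ∀ a b c → a + b - c ≡ a + (b - c)
      a+b-c≡a+[b-c] = solve-∀
      w = residue (x + toℤ v)
      w-u≈ : toℤ w - toℤ u ≈ x + (toℤ v - toℤ u)
      w-u≈ = begin
        toℤ w - toℤ u                 ≈⟨ +-congʳ (- toℤ u) (toℤ-residue (x + toℤ v)) ⟩
        x + toℤ v - toℤ u             ≡⟨ a+b-c≡a+[b-c] x (toℤ v) (toℤ u) ⟩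
        x + (toℤ v - toℤ u)           ∎
      w-v≈x : toℤ w - toℤ v ≈ x
      w-v≈x = begin
        toℤ w - toℤ v                 ≈⟨ +-congʳ (- toℤ v) (toℤ-residue (x + toℤ v)) ⟩
        x + toℤ v - toℤ v             ≡⟨ a+b-c≡a+[b-c] x (toℤ v) (toℤ v) ⟩
        x + (toℤ v - toℤ v)           ≡⟨ cong (λ y → x + y) (ℤ.+-inverseʳ (toℤ v)) ⟩
        x + 0ℤ                        ≡⟨ ℤ.+-identityʳ x ⟩
        x                             ∎

  twoSuccessors⇒twoRepresentations : ∀ {m} u v → + m ≈ toℤ v - toℤ u → + m + + m ≉ 0ℤ →
                                     ∀ {w₁ w₂} → w₁ ∈ Out A u ∩ Out A v → w₂ ∈ Out A u ∩ Out A v → w₁ ≢ w₂ →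
                                     TwoRepresentations m
  twoSuccessors⇒twoRepresentations {m} u v m≈v-u 2m≉0 {w₁} {w₂} w₁∈ w₂∈ w₁≢w₂ =
    i w₁ , j w₁ , i w₂ , j w₂ , i∈S w₁∈ , j∈S w₁∈ , i∈S w₂∈ , j∈S w₂∈ , i≢j w₁ , i≢j w₂ , distinct ,
    DiffCong⁺ (i w₁) (j w₁) (i-j≈m w₁) , DiffCong⁺ (i w₂) (j w₂) (i-j≈m w₂)
    where
      i j : Fin n → Fin n
      i w = residue (toℤ w - toℤ u)
      j w = residue (toℤ w - toℤ v)

      i∈S : ∀ {w} → w ∈ Out A u ∩ Out A v → i w ∈ S
      i∈S {w} w∈ = ∈ᵣ⇒residue∈ (proj₁ (∈Out∩⁻ u v w w∈))
      j∈S : ∀ {w} → w ∈ Out A u ∩ Out A v → j w ∈ S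
      j∈S {w} w∈ = ∈ᵣ⇒residue∈ (proj₂ (∈Out∩⁻ u v w w∈))

      i-j≈m : ∀ w → toℤ (i w) - toℤ (j w) ≈ + m
      i-j≈m w = begin
        toℤ (i w) - toℤ (j w)              ≈⟨ residue-difference (toℤ w - toℤ u) (toℤ w - toℤ v) ⟩
        (toℤ w - toℤ u) - (toℤ w - toℤ v)  ≡⟨ [a-b]-[a-c]≡c-b (toℤ w) (toℤ u) (toℤ v) ⟩
        toℤ v - toℤ u                      ≈⟨ m≈v-u ⟨
        + m                                ∎
        where
          open SetoidReasoning ≈-setoid
          [a-b]-[a-c]≡c-b : ∀ a b c → (a - b) - (a - c) ≡ c - b
          [a-b]-[a-c]≡c-b = solve-∀

      i≢j : ∀ w → i w ≢ j w
      i≢j w iw≡jw = 2m≉0 (≈-trans (+-cong m≈0 m≈0) (≈-reflexive (ℤ.+-identityˡ 0ℤ)))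
        where
          m≈0 : + m ≈ 0ℤ
          m≈0 = ≈-trans (≈-sym (i-j≈m w)) (≈-reflexive (≡.trans (cong (λ x → toℤ (i w) - toℤ x) (≡.sym iw≡jw))
                                                                (ℤ.+-inverseʳ (toℤ (i w)))))

      distinct : ¬ ((i w₁ ≡ i w₂ × j w₁ ≡ j w₂) ⊎ (i w₁ ≡ j w₂ × j w₁ ≡ i w₂))
      distinct (inj₁ (i₁≡i₂ , _)) = w₁≢w₂ (toℤ-≈-injective (+-cancelʳ-≈ (- toℤ u) (residue-injective i₁≡i₂)))
      distinct (inj₂ (i₁≡j₂ , j₁≡i₂)) =
        2m≉0 (opposite-differences (toℤ (i w₁)) (toℤ (j w₁)) (i-j≈m w₁) j₁-i₁≈m)
        where
          j₁-i₁≈m : toℤ (j w₁) - toℤ (i w₁) ≈ + m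
          j₁-i₁≈m = subst₂ (λ a b → toℤ a - toℤ b ≈ + m) (≡.sym j₁≡i₂) (≡.sym i₁≡j₂) (i-j≈m w₂)

  module _ {m} (nd : NonDifference S m) (m∉S : m ∉ᵣ S) (m≉0 : m ≉ 0ℤ) where

    nonDifference⇒2m∈Out0∩Out3m : m + m ≉ 0ℤ → residue (m + m) ∈ Out A fzero ∩ Out A (residue (m + m + m))
    nonDifference⇒2m∈Out0∩Out3m 2m≉0 =
      ∈Out∩⁺ fzero v w₀ (∈ᵣ-resp-≈ (≈-sym w₀-0≈2m) 2m∈S) (∈ᵣ-resp-≈ (≈-sym w₀-v≈-m) (∉ᵣ⇒-∈ᵣ m≉0 m∉S))
      where
        open SetoidReasoning ≈-setoid
        v = residue (m + m + m)
        w₀ = residue (m + m)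
        2m∈S : m + m ∈ᵣ S
        2m∈S = [ ⊥-elim ∘ m∉S , id ]′ (nonDifference-covers nd m≉0 2m≉0)
        w₀-0≈2m : toℤ w₀ - 0ℤ ≈ m + m
        w₀-0≈2m = ≈-trans (≈-reflexive (ℤ.+-identityʳ (toℤ w₀))) (toℤ-residue (m + m))
        w₀-v≈-m : toℤ w₀ - toℤ v ≈ - m
        w₀-v≈-m = begin
          toℤ w₀ - toℤ v           ≈⟨ residue-difference (m + m) (m + m + m) ⟩
          (m + m) - (m + m + m)    ≡⟨ solve (m ∷ []) ⟩
          - m                      ∎

    nonDifference⇒Out0∩Out3m-unique : ∀ {w} → w ∈ Out A fzero ∩ Out A (residue (m + m + m)) →
                                      w ≡ residue (m + m)
    nonDifference⇒Out0∩Out3m-unique {w} w∈ = toℤ-≈-injective (begin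
      toℤ w                       ≡⟨ a≡a-b+b (toℤ w) (toℤ v) ⟩
      (toℤ w - toℤ v) + toℤ v     ≈⟨ +-cong w-v≈-m (toℤ-residue (m + m + m)) ⟩
      - m + (m + m + m)           ≡⟨ solve (m ∷ []) ⟩
      m + m                       ≈⟨ toℤ-residue (m + m) ⟨
      toℤ (residue (m + m))       ∎)
      where
        open SetoidReasoning ≈-setoid
        a≡a-b+b : ∀ a b → a ≡ a - b + b
        a≡a-b+b = solve-∀
        v = residue (m + m + m)
        w-0≈w-v+3m : toℤ w - 0ℤ ≈ (toℤ w - toℤ v) + (m + m + m)
        w-0≈w-v+3m = begin
          toℤ w - 0ℤ                      ≡⟨ ℤ.+-identityʳ (toℤ w) ⟩
          toℤ w                           ≡⟨ a≡a-b+b (toℤ w) (toℤ v) ⟩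
          (toℤ w - toℤ v) + toℤ v         ≈⟨ +-congˡ (toℤ w - toℤ v) (toℤ-residue (m + m + m)) ⟩
          (toℤ w - toℤ v) + (m + m + m)   ∎
        w-v≈-m : toℤ w - toℤ v ≈ - m
        w-v≈-m = let w-0∈S , w-v∈S = ∈Out∩⁻ fzero v w w∈ in
          nonDifference-unique nd m∉S m≉0 w-v∈S (∈ᵣ-resp-≈ w-0≈w-v+3m w-0∈S)

    nonDifference⇒¬quadrangular : m + m ≉ 0ℤ → m + m + m ≉ 0ℤ → ¬ Quadrangular A
    nonDifference⇒¬quadrangular 2m≉0 3m≉0 Q = proj₁ (Q fzero (residue (m + m + m)) 0≢3m)
      (∈-unique⇒∣p∣≡1 (nonDifference⇒2m∈Out0∩Out3m 2m≉0) nonDifference⇒Out0∩Out3m-unique)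
      where
        0≢3m : fzero ≢ residue (m + m + m)
        0≢3m 0≡3m = 3m≉0 (≈-sym (subst (λ x → toℤ x ≈ m + m + m) (≡.sym 0≡3m) (toℤ-residue (m + m + m))))

  quadrangular⇒¬nonDifference : 3 < n → Quadrangular A → ∀ {m} → m ≉ 0ℤ → m + m ≉ 0ℤ → ¬ NonDifference S m
  quadrangular⇒¬nonDifference 3<n Q {m} m≉0 2m≉0 nd with m + m + m ≈? 0ℤ | m ∈ᵣ? S
  ... | yes 3m≈0 | _       = nonDifference-of-order-3 (+≉0 (ℕ.s≤s ℕ.z≤n) 3<n) 3m≈0 nd
  ... | no 3m≉0  | no m∉S  = nonDifference⇒¬quadrangular nd m∉S m≉0 2m≉0 3m≉0 Q
  ... | no 3m≉0  | yes m∈S =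
    nonDifference⇒¬quadrangular (nonDifference-neg nd) (IsTournamentSymbol.asym S-tournament m∈S) (-‿≉0 m≉0)
      (subst (_≉ 0ℤ) (-[a+a]≡-a+-a m) (-‿≉0 2m≉0)) (subst (_≉ 0ℤ) (-[a+a+a]≡-a+-a+-a m) (-‿≉0 3m≉0)) Q
    where
      -[a+a]≡-a+-a : ∀ a → - (a + a) ≡ - a + - a
      -[a+a]≡-a+-a = solve-∀
      -[a+a+a]≡-a+-a+-a : ∀ a → - (a + a + a) ≡ - a + - a + - a
      -[a+a+a]≡-a+-a+-a = solve-∀

  quadrangular⇒twoRepresentations : 3 < n → Quadrangular A → ∀ m → 1 ≤ m → m ≤ r → TwoRepresentations m
  quadrangular⇒twoRepresentations 3<n Q m 1≤m m≤r =
    let w₁ , w₁∈ = some-common-successor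
        w₂ , w₂∈ , w₂≢w₁ = ∣p∣≢1⇒∃≢ w₁∈ (proj₁ (Q u v u≢v))
    in twoSuccessors⇒twoRepresentations u v m≈v-u 2m≉0 w₁∈ w₂∈ (w₂≢w₁ ∘ ≡.sym)
    where
      u v : Fin n
      u = fzero
      v = residue (+ m)

      m≈v-u : + m ≈ toℤ v - 0ℤ
      m≈v-u = ≈-sym (≈-trans (≈-reflexive (ℤ.+-identityʳ (toℤ v))) (toℤ-residue (+ m)))
      m≉0 : + m ≉ 0ℤ
      m≉0 = +≉0 1≤m (ℕ.≤-<-trans (ℕ.m≤m+n m m) (m≤r⇒m+m<n m≤r))
      2m≉0 : + m + + m ≉ 0ℤ
      2m≉0 = subst (_≉ 0ℤ) (ℤ.pos-+ m m) (+≉0 (ℕ.<-≤-trans 1≤m (ℕ.m≤m+n m m)) (m≤r⇒m+m<n m≤r))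

      u≢v : u ≢ v
      u≢v u≡v = m≉0 (≈-trans m≈v-u (≈-reflexive (≡.trans (cong (λ x → toℤ x - 0ℤ) (≡.sym u≡v)) refl)))

      some-common-successor : ∃[ w ] (w ∈ Out A u ∩ Out A v)
      some-common-successor = decidable-stable (nonempty? (Out A u ∩ Out A v)) λ ∄w →
        quadrangular⇒¬nonDifference 3<n Q m≉0 2m≉0
          (nonDifference-resp-≈ (≈-sym m≈v-u) (noCommonSuccessor⇒nonDifference u v ∄w))

theorem20 : (r : ℕ) → 3 < suc (2 * r) → (S : Subset (suc (2 * r))) → IsSymbol r S →
    Quadrangular (rotational r S) ⇔
      ((m : ℕ) → 1 ≤ m → m ≤ r →
        ∃[ i ] ∃[ j ] ∃[ k ] ∃[ l ]
          (i ∈ S × j ∈ S × k ∈ S × l ∈ S × i ≢ j × k ≢ l ×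
           ¬ ((i ≡ k × j ≡ l) ⊎ (i ≡ l × j ≡ k)) ×
           DiffCong r i j m × DiffCong r k l m))
theorem20 r 3<n S isSymbol =
  mk⇔ (quadrangular⇒twoRepresentations 3<n) twoRepresentations⇒quadrangular
  where open RotationalTournament r S isSymbol
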